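{- $F_e(K_3,K_3;\widehat{K}_{4,2}) = F_e(K_3,K_3;\widehat{K}_{4,1}) = F_e(3,3;4)$.
   Context: All graphs are finite, undirected and simple. $\widehat{K}_{n,s}$ denotes the graph obtained from $K_n$ by adding a new vertex adjacent to exactly $s$ vertices of the $K_n$. A graph is $H$-free if it contains no subgraph isomorphic to $H$. $G \rightarrow (K_3,K_3)^e$ means every red-blue coloring of the edges of $G$ contains a monochromatic triangle. $F_e(K_3,K_3;H)$ is the smallest $n$ such that there is an $H$-free graph $G$ on $n$ vertices with $G \rightarrow (K_3,K_3)^e$, and $F_e(3,3;4) = F_e(K_3,K_3;K_4)$ (which is known to exist). -}

module Defs where

open import Data.Nat using (ℕ; zero; suc; _≤_; _<ᵇ_; _≡ᵇ_)
open import Data.Fin using (Fin; toℕ)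
open import Data.Bool using (Bool; true; false; not; _∧_; _∨_)
open import Data.Product using (Σ; _×_; ∃)
open import Relation.Binary.PropositionalEquality using (_≡_)
open import Relation.Nullary using (¬_)
open import Function.Definitions using (Injective)

record Graph (n : ℕ) : Set where
  field
    adj   : Fin n → Fin n → Bool
    sym   : ∀ i j → adj i j ≡ adj j i
    irref : ∀ i → adj i i ≡ false
open Graph public

completeAdj : (n : ℕ) → Fin n → Fin n → Bool
completeAdj n i j = not (toℕ i ≡ᵇ toℕ j)

-- Adjacency of \hat K_{n,s} on Fin (suc n): vertices 0..n-1 form K_n,
-- vertex n is the new vertex, adjacent exactly to vertices 0..s-1 (s ≤ n).
hatAdj : (n s : ℕ) → Fin (suc n) → Fin (suc n) → Bool
hatAdj n s i j =
  not (toℕ i ≡ᵇ toℕ j) ∧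
  (((toℕ i <ᵇ n) ∧ (toℕ j <ᵇ n)) ∨ (toℕ i <ᵇ s) ∨ (toℕ j <ᵇ s))

Contains : ∀ {n k} → Graph n → (Fin k → Fin k → Bool) → Set
Contains {n} {k} G h =
  Σ (Fin k → Fin n) λ f →
    Injective _≡_ _≡_ f × (∀ i j → h i j ≡ true → adj G (f i) (f j) ≡ true)

Free : ∀ {n k} → Graph n → (Fin k → Fin k → Bool) → Set
Free G h = ¬ Contains G h

-- A red/blue colouring of the edges of G: a symmetric Bool-valued function
-- on pairs (its values on non-edges are irrelevant).
SymColouring : ℕ → Set
SymColouring n = Σ (Fin n → Fin n → Bool) λ c → ∀ i j → c i j ≡ c j i

MonoTriangle : ∀ {n} → Graph n → (Fin n → Fin n → Bool) → Set
MonoTriangle {n} G c =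
  Σ (Fin n) λ a → Σ (Fin n) λ b → Σ (Fin n) λ d → Σ Bool λ col →
    adj G a b ≡ true × adj G b d ≡ true × adj G a d ≡ true ×
    c a b ≡ col × c b d ≡ col × c a d ≡ col

Arrows : ∀ {n} → Graph n → Set
Arrows {n} G = (c : SymColouring n) → MonoTriangle G (Data.Product.proj₁ c)

FolkmanGraphExists : ∀ {k} → (Fin k → Fin k → Bool) → ℕ → Set
FolkmanGraphExists h n = Σ (Graph n) λ G → Free G h × Arrows G

IsLeast : (ℕ → Set) → ℕ → Set
IsLeast P m = P m × (∀ n → P n → m ≤ n)

IsFe : ∀ {k} → (Fin k → Fin k → Bool) → ℕ → Set
IsFe h m = IsLeast (FolkmanGraphExists h) m

module Submission where

-- In a K̂₄,₂-free graph an edge uv of a K₄ uvxy has no common neighbours besides x and y, so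
-- every triangle containing uv lies inside uvxy. Hence deleting all edges of K₄'s from a
-- K̂₄,₂-free graph G leaves a K₄-free graph G′ on the same vertices that still arrows
-- (K₃,K₃)ᵉ: a colouring of G′ extends to G by colouring each K₄ p < q < r < s along the vertex
-- order, an edge getting colour true iff another vertex of its K₄ lies strictly between its
-- ends. The two colour classes are the paths r p s q and p q r s, so no new monochromatic
-- triangle appears. Together with K₄ ⊆ K̂₄,₁ ⊆ K̂₄,₂ this makes the three numbers equal.

open import Defs hiding (sym)
open import Data.Bool using (Bool; true; false; not; _∧_; _∨_; if_then_else_)
open import Data.Bool.Properties using (T-≡; ∨-zeroʳ) renaming (_≟_ to _≟ᵇ_)
open import Data.Empty using (⊥; ⊥-elim)
open import Data.Fin using (Fin; toℕ; inject₁)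
open import Data.Fin.Patterns using (0F; 1F; 2F; 3F; 4F)
open import Data.Fin.Properties using (_≟_; any?; toℕ<n; toℕ-inject₁; inject₁-injective)
  renaming (<-strictTotalOrder to Fin-<-strictTotalOrder)
open import Data.Nat using (ℕ; _≤_; _<ᵇ_; _≡ᵇ_; z≤n; s≤s)
open import Data.Nat.Properties using (<ᵇ⇒<; <⇒<ᵇ; <-≤-trans)
open import Data.Product using (Σ; ∃-syntax; ∃₂; _×_; _,_; proj₁; proj₂)
open import Data.Sum using (_⊎_; inj₁; inj₂; [_,_])
import Data.Sum as Sum
open import Data.Vec using (_∷_; []; lookup)
open import Data.Vec.Relation.Unary.All using (_∷_; [])
open import Data.Vec.Relation.Unary.AllPairs using (_∷_; [])
open import Data.Vec.Relation.Unary.Unique.Propositional using (Unique)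
open import Data.Vec.Relation.Unary.Unique.Propositional.Properties using (lookup-injective)
open import Function using (_∘_; case_of_)
open import Function.Bundles using (_⇔_; mk⇔; Equivalence)
open import Function.Definitions using (Injective)
open import Relation.Binary.Bundles using (StrictTotalOrder)
open import Relation.Binary.Definitions using (tri<; tri≈; tri>)
open import Relation.Binary.PropositionalEquality using (_≡_; _≢_; refl; sym; trans; cong₂; ≢-sym)
open import Relation.Nullary using (¬_; contradiction; Dec; does; yes; no; map′; _×-dec_; _⊎-dec_)
open import Relation.Nullary.Decidable using (dec-true; dec-false; does-⇔)

not-all-equal : ∀ {p q r c : Bool} → p ≡ true × (q ≡ false ⊎ r ≡ false) → p ≡ c → q ≡ c → r ≡ c → ⊥
not-all-equal (refl , inj₁ refl) refl () _
not-all-equal (refl , inj₂ refl) refl _ ()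

∧-not-true : ∀ {p q} → p ∧ not q ≡ true → p ≡ true × q ≡ false
∧-not-true {true} {false} refl = refl , refl

∨-preserves-true : ∀ {p q p′ q′} → (p ≡ true → p′ ≡ true) → (q ≡ true → q′ ≡ true) →
                   p ∨ q ≡ true → p′ ∨ q′ ≡ true
∨-preserves-true {true}             f _ _ rewrite f refl = refl
∨-preserves-true {false} {p′ = p′} _ g h rewrite g h    = ∨-zeroʳ p′

<ᵇ-monoʳ : ∀ {m s t} → s ≤ t → (m <ᵇ s) ≡ true → (m <ᵇ t) ≡ true
<ᵇ-monoʳ {m} {s} s≤t m<s =
  Equivalence.to T-≡ (<⇒<ᵇ (<-≤-trans (<ᵇ⇒< m s (Equivalence.from T-≡ m<s)) s≤t))

IsLeast-cong : ∀ {P Q : ℕ → Set} → (∀ n → P n ⇔ Q n) → ∀ m → IsLeast P m ⇔ IsLeast Q m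
IsLeast-cong P⇔Q m = mk⇔ (transport (to ∘ P⇔Q) (from ∘ P⇔Q)) (transport (from ∘ P⇔Q) (to ∘ P⇔Q))
  where
  open Equivalence
  transport : ∀ {P Q : ℕ → Set} → (∀ n → P n → Q n) → (∀ n → Q n → P n) → IsLeast P m → IsLeast Q m
  transport P⇒Q Q⇒P (Pm , least) = P⇒Q m Pm , λ n → least n ∘ Q⇒P n

-- Contains G h is definitionally Embedding h (adj G).
Embedding : ∀ {k l} → (Fin k → Fin k → Bool) → (Fin l → Fin l → Bool) → Set
Embedding {k} {l} h h′ =
  Σ (Fin k → Fin l) λ f → Injective _≡_ _≡_ f × (∀ i j → h i j ≡ true → h′ (f i) (f j) ≡ true)

Embedding-trans : ∀ {k l m} {h₁ : Fin k → Fin k → Bool} {h₂ : Fin l → Fin l → Bool}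
                  {h₃ : Fin m → Fin m → Bool} → Embedding h₁ h₂ → Embedding h₂ h₃ → Embedding h₁ h₃
Embedding-trans (f , f-inj , f-hom) (g , g-inj , g-hom) =
  g ∘ f , f-inj ∘ g-inj , λ i j → g-hom (f i) (f j) ∘ f-hom i j

FolkmanGraphExists-mono : ∀ {k l m} {h : Fin k → Fin k → Bool} {h′ : Fin l → Fin l → Bool} →
                          Embedding h h′ → FolkmanGraphExists h m → FolkmanGraphExists h′ m
FolkmanGraphExists-mono e (G , free , arrows) = G , free ∘ Embedding-trans {h₃ = adj G} e , arrows

complete↪hat : ∀ n s → Embedding (completeAdj n) (hatAdj n s)
complete↪hat n s = inject₁ , inject₁-injective , hom
  where
  hom : ∀ i j → completeAdj n i j ≡ true → hatAdj n s (inject₁ i) (inject₁ j) ≡ true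
  hom i j i≢j rewrite toℕ-inject₁ i | toℕ-inject₁ j | i≢j
                    | Equivalence.to T-≡ (<⇒<ᵇ (toℕ<n i)) | Equivalence.to T-≡ (<⇒<ᵇ (toℕ<n j)) = refl

hat↪hat : ∀ {n s t} → s ≤ t → Embedding (hatAdj n s) (hatAdj n t)
hat↪hat {n} {s} {t} s≤t = (λ i → i) , (λ e → e) , hom
  where
  hom : ∀ i j → hatAdj n s i j ≡ true → hatAdj n t i j ≡ true
  hom i j h with not (toℕ i ≡ᵇ toℕ j) | (toℕ i <ᵇ n) ∧ (toℕ j <ᵇ n)
  ... | true | true  = refl
  ... | true | false = ∨-preserves-true (<ᵇ-monoʳ s≤t) (<ᵇ-monoʳ s≤t) h
  ... | false | _    = h

module Betweenness {a ℓ₁ ℓ₂} (O : StrictTotalOrder a ℓ₁ ℓ₂) where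
  open StrictTotalOrder O renaming (Carrier to A; trans to <-trans)

  Between : A → A → A → Set ℓ₂
  Between x u v = (u < x × x < v) ⊎ (v < x × x < u)

  between? : ∀ x u v → Dec (Between x u v)
  between? x u v = (u <? x ×-dec x <? v) ⊎-dec (v <? x ×-dec x <? u)

  Between-sym : ∀ {x u v} → Between x u v → Between x v u
  Between-sym = Sum.swap

  Between-middle : ∀ {u v w} → ¬ u ≈ v → ¬ v ≈ w → ¬ u ≈ w →
                   Between v u w ⊎ Between u v w ⊎ Between w u v
  Between-middle {u} {v} {w} u≉v v≉w u≉w with compare u v | compare v w | compare u w
  ... | tri≈ _ u≈v _ | _            | _            = ⊥-elim (u≉v u≈v)
  ... | _            | tri≈ _ v≈w _ | _            = ⊥-elim (v≉w v≈w)
  ... | _            | _            | tri≈ _ u≈w _ = ⊥-elim (u≉w u≈w)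
  ... | tri< u<v _ _ | tri< v<w _ _ | _            = inj₁ (inj₁ (u<v , v<w))
  ... | tri> _ _ v<u | tri> _ _ w<v | _            = inj₁ (inj₂ (w<v , v<u))
  ... | tri< _ _ _   | tri> _ _ w<v | tri< u<w _ _ = inj₂ (inj₂ (inj₁ (u<w , w<v)))
  ... | tri< u<v _ _ | tri> _ _ _   | tri> _ _ w<u = inj₂ (inj₁ (inj₂ (w<u , u<v)))
  ... | tri> _ _ v<u | tri< _ _ _   | tri< u<w _ _ = inj₂ (inj₁ (inj₁ (v<u , u<w)))
  ... | tri> _ _ _   | tri< v<w _ _ | tri> _ _ w<u = inj₂ (inj₂ (inj₂ (v<w , w<u)))

  Between⇒¬Between-end : ∀ {m u v} → Between m u v → ¬ Between v u m
  Between⇒¬Between-end (inj₁ (_   , m<v)) (inj₁ (_ , v<m)) = asym m<v v<m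
  Between⇒¬Between-end (inj₁ (u<m , m<v)) (inj₂ (_ , v<u)) = asym (<-trans u<m m<v) v<u
  Between⇒¬Between-end (inj₂ (v<m , m<u)) (inj₁ (u<v , _)) = asym (<-trans v<m m<u) u<v
  Between⇒¬Between-end (inj₂ (v<m , _  )) (inj₂ (m<v , _)) = asym m<v v<m

  Between-sides-disjoint : ∀ {m u v x} → Between m u v → Between x u m → ¬ Between x m v
  Between-sides-disjoint (inj₁ (u<m , m<v)) = sorted u<m m<v
    where
    sorted : ∀ {u m v x} → u < m → m < v → Between x u m → ¬ Between x m v
    sorted _   _   (inj₁ (_ , x<m))   (inj₁ (m<x , _)) = asym x<m m<x
    sorted _   m<v (inj₁ (_ , x<m))   (inj₂ (v<x , _)) = asym (<-trans m<v v<x) x<m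
    sorted u<m _   (inj₂ (m<x , x<u)) _                = asym (<-trans u<m m<x) x<u
  Between-sides-disjoint (inj₂ (v<m , m<u)) x-um x-mv =
    Between-sides-disjoint (inj₁ (v<m , m<u)) (Between-sym x-mv) (Between-sym x-um)

  Spans : A → A → A → A → Set ℓ₂
  Spans u v x y = Between x u v ⊎ Between y u v

  spans? : ∀ u v x y → Dec (Spans u v x y)
  spans? u v x y = between? x u v ⊎-dec between? y u v

  spans : A → A → A → A → Bool
  spans u v x y = does (spans? u v x y)

  spans-sym : ∀ u v x y → spans u v x y ≡ spans v u x y
  spans-sym u v x y = does-⇔ (mk⇔ flip flip) (spans? u v x y) (spans? v u x y)
    where
    flip : ∀ {u v} → Spans u v x y → Spans v u x y
    flip = Sum.map Between-sym Between-sym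

  spans-middle : ∀ {m u v} → Between m u v → ∀ x →
                 spans u v m x ≡ true × (spans u m v x ≡ false ⊎ spans m v u x ≡ false)
  spans-middle {m} {u} {v} m-uv x = dec-true (spans? u v m x) (inj₁ m-uv) , short
    where
    short : spans u m v x ≡ false ⊎ spans m v u x ≡ false
    short with between? x u m
    ... | yes x-um = inj₂ (dec-false (spans? m v u x)
                      [ Between⇒¬Between-end (Between-sym m-uv) ∘ Between-sym
                      , Between-sides-disjoint m-uv x-um ])
    ... | no ¬x-um = inj₁ (dec-false (spans? u m v x) [ Between⇒¬Between-end m-uv , ¬x-um ])

  spans-not-monochromatic : ∀ {u v w} → ¬ u ≈ v → ¬ v ≈ w → ¬ u ≈ w → ∀ x {c} →
    spans u v w x ≡ c → spans v w u x ≡ c → spans u w v x ≡ c → ⊥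
  spans-not-monochromatic {u} {v} {w} u≉v v≉w u≉w x uv vw uw with Between-middle u≉v v≉w u≉w
  ... | inj₁ v-uw        = not-all-equal (spans-middle v-uw x) uw uv vw
  ... | inj₂ (inj₁ u-vw) = not-all-equal (spans-middle u-vw x) vw (trans (sym (spans-sym u v w x)) uv) uw
  ... | inj₂ (inj₂ w-uv) = not-all-equal (spans-middle w-uv x) uv uw (trans (sym (spans-sym v w u x)) vw)

module K4Removal {n} (G : Graph n) where

  open Betweenness (Fin-<-strictTotalOrder n)

  Edge : Fin n → Fin n → Set
  Edge u v = adj G u v ≡ true

  edge? : ∀ u v → Dec (Edge u v)
  edge? u v = adj G u v ≟ᵇ true

  Edge-sym : ∀ {u v} → Edge u v → Edge v u
  Edge-sym {u} {v} = trans (Graph.sym G v u)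

  Edge⇒≢ : ∀ {u v} → Edge u v → u ≢ v
  Edge⇒≢ {u} e refl with trans (sym e) (irref G u)
  ... | ()

  record K4 (a b c d : Fin n) : Set where
    constructor k4
    field
      ab : Edge a b
      ac : Edge a c
      ad : Edge a d
      bc : Edge b c
      bd : Edge b d
      cd : Edge c d

  K4? : ∀ a b c d → Dec (K4 a b c d)
  K4? a b c d = map′ (λ (ab , ac , ad , bc , bd , cd) → k4 ab ac ad bc bd cd)
                     (λ (k4 ab ac ad bc bd cd) → ab , ac , ad , bc , bd , cd)
                     (edge? a b ×-dec edge? a c ×-dec edge? a d ×-dec
                      edge? b c ×-dec edge? b d ×-dec edge? c d)

  K4-swap₁₂ : ∀ {a b c d} → K4 a b c d → K4 b a c d
  K4-swap₁₂ (k4 ab ac ad bc bd cd) = k4 (Edge-sym ab) bc bd ac ad cd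

  K4-swap₂₃ : ∀ {a b c d} → K4 a b c d → K4 a c b d
  K4-swap₂₃ (k4 ab ac ad bc bd cd) = k4 ac ab ad (Edge-sym bc) cd bd

  K4-swap₃₄ : ∀ {a b c d} → K4 a b c d → K4 a b d c
  K4-swap₃₄ (k4 ab ac ad bc bd cd) = k4 ab ad ac bd bc (Edge-sym cd)

  InK4 : Fin n → Fin n → Set
  InK4 u v = ∃₂ λ x y → K4 u v x y

  inK4? : ∀ u v → Dec (InK4 u v)
  inK4? u v = any? λ x → any? λ y → K4? u v x y

  InK4-sym : ∀ {u v} → InK4 u v → InK4 v u
  InK4-sym (x , y , q) = x , y , K4-swap₁₂ q

  does-inK4?-sym : ∀ u v → does (inK4? u v) ≡ does (inK4? v u)
  does-inK4?-sym u v = does-⇔ (mk⇔ InK4-sym InK4-sym) (inK4? u v) (inK4? v u)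

  removeK4 : Graph n
  removeK4 = record
    { adj   = λ u v → adj G u v ∧ not (does (inK4? u v))
    ; sym   = λ u v → cong₂ (λ e k → e ∧ not k) (Graph.sym G u v) (does-inK4?-sym u v)
    ; irref = λ u → cong₂ (λ e k → e ∧ not k) (irref G u) refl
    }

  removeK4-edge : ∀ {u v} → Edge u v → ¬ InK4 u v → adj removeK4 u v ≡ true
  removeK4-edge {u} {v} e ¬k = cong₂ (λ p k → p ∧ not k) e (dec-false (inK4? u v) ¬k)

  removeK4-edge⁻¹ : ∀ {u v} → adj removeK4 u v ≡ true → Edge u v × ¬ InK4 u v
  removeK4-edge⁻¹ {u} {v} e with ∧-not-true e
  ... | uv , ¬k = uv , λ k → contradiction (trans (sym (dec-true (inK4? u v) k)) ¬k) λ ()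

  removeK4-K4-free : Free removeK4 (completeAdj 4)
  removeK4-K4-free (f , _ , hom) = proj₂ (kept 0F 1F refl) (f 2F , f 3F , K4-image)
    where
    kept : ∀ i j → completeAdj 4 i j ≡ true → Edge (f i) (f j) × ¬ InK4 (f i) (f j)
    kept i j = removeK4-edge⁻¹ ∘ hom i j
    K4-image : K4 (f 0F) (f 1F) (f 2F) (f 3F)
    K4-image = k4 (proj₁ (kept 0F 1F refl)) (proj₁ (kept 0F 2F refl)) (proj₁ (kept 0F 3F refl))
                  (proj₁ (kept 1F 2F refl)) (proj₁ (kept 1F 3F refl)) (proj₁ (kept 2F 3F refl))

  K4-extends-to-hat₄₂ : ∀ {a b c d x} → K4 a b c d → Edge a x → Edge b x → x ≢ c → x ≢ d →
                        Contains G (hatAdj 4 2)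
  K4-extends-to-hat₄₂ {a} {b} {c} {d} {x} (k4 ab ac ad bc bd cd) ax bx x≢c x≢d =
    lookup vs , (λ {i} {j} → lookup-injective distinct i j) , hom
    where
    vs = a ∷ b ∷ c ∷ d ∷ x ∷ []
    distinct : Unique vs
    distinct = (Edge⇒≢ ab ∷ Edge⇒≢ ac ∷ Edge⇒≢ ad ∷ Edge⇒≢ ax ∷ [])
             ∷ (Edge⇒≢ bc ∷ Edge⇒≢ bd ∷ Edge⇒≢ bx ∷ [])
             ∷ (Edge⇒≢ cd ∷ ≢-sym x≢c ∷ [])
             ∷ (≢-sym x≢d ∷ [])
             ∷ [] ∷ []
    hom : ∀ i j → hatAdj 4 2 i j ≡ true → Edge (lookup vs i) (lookup vs j)
    hom 0F 1F _ = ab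
    hom 0F 2F _ = ac
    hom 0F 3F _ = ad
    hom 0F 4F _ = ax
    hom 1F 0F _ = Edge-sym ab
    hom 1F 2F _ = bc
    hom 1F 3F _ = bd
    hom 1F 4F _ = bx
    hom 2F 0F _ = Edge-sym ac
    hom 2F 1F _ = Edge-sym bc
    hom 2F 3F _ = cd
    hom 3F 0F _ = Edge-sym ad
    hom 3F 1F _ = Edge-sym bd
    hom 3F 2F _ = Edge-sym cd
    hom 4F 0F _ = Edge-sym ax
    hom 4F 1F _ = Edge-sym bx
    hom 3F 3F ()
    hom 3F 4F ()
    hom 4F 2F ()
    hom 4F 3F ()
    hom 4F 4F ()

  InnerCommonNeighbour : Fin n → Fin n → Fin n → Set
  InnerCommonNeighbour u v w = Edge u w × Edge v w × Between w u v

  innerCommonNeighbour? : ∀ u v → Dec (∃[ w ] InnerCommonNeighbour u v w)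
  innerCommonNeighbour? u v = any? λ w → edge? u w ×-dec edge? v w ×-dec between? w u v

  -- Unlike spans, this needs no choice of a K₄ through uv and so is symmetric by construction;
  -- innerColour-K4 shows the two agree on K₄ edges.
  innerColour : Fin n → Fin n → Bool
  innerColour u v = does (innerCommonNeighbour? u v)

  innerColour-sym : ∀ u v → innerColour u v ≡ innerColour v u
  innerColour-sym u v = does-⇔ (mk⇔ flip flip) (innerCommonNeighbour? u v) (innerCommonNeighbour? v u)
    where
    flip : ∀ {u v} → ∃[ w ] InnerCommonNeighbour u v w → ∃[ w ] InnerCommonNeighbour v u w
    flip (w , uw , vw , w-uv) = w , vw , uw , Between-sym w-uv

  module _ (free : Free G (hatAdj 4 2)) where

    K4-common-neighbour : ∀ {a b c d x} → K4 a b c d → Edge a x → Edge b x → x ≡ c ⊎ x ≡ d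
    K4-common-neighbour {c = c} {d} {x} q ax bx with x ≟ c | x ≟ d
    ... | yes x≡c | _       = inj₁ x≡c
    ... | no _    | yes x≡d = inj₂ x≡d
    ... | no x≢c  | no x≢d  = ⊥-elim (free (K4-extends-to-hat₄₂ q ax bx x≢c x≢d))

    K4-extend : ∀ {a b d} → InK4 a b → Edge a d → Edge b d → ∃[ e ] K4 a b d e
    K4-extend (x , y , q) ad bd with K4-common-neighbour q ad bd
    ... | inj₁ refl = y , q
    ... | inj₂ refl = x , K4-swap₃₄ q

    InK4-triangle : ∀ {a b d} → InK4 a b → Edge a d → Edge b d → InK4 a d × InK4 b d
    InK4-triangle k ad bd with K4-extend k ad bd
    ... | e , q = (_ , e , K4-swap₂₃ q) , (_ , e , K4-swap₂₃ (K4-swap₁₂ q))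

    innerColour-K4 : ∀ {u v x y} → K4 u v x y → innerColour u v ≡ spans u v x y
    innerColour-K4 {u} {v} {x} {y} q = does-⇔ (mk⇔ to from) (innerCommonNeighbour? u v) (spans? u v x y)
      where
      to : ∃[ w ] InnerCommonNeighbour u v w → Spans u v x y
      to (w , uw , vw , w-uv) with K4-common-neighbour q uw vw
      ... | inj₁ refl = inj₁ w-uv
      ... | inj₂ refl = inj₂ w-uv
      from : Spans u v x y → ∃[ w ] InnerCommonNeighbour u v w
      from (inj₁ x-uv) = x , K4.ac q , K4.bc q , x-uv
      from (inj₂ y-uv) = y , K4.ad q , K4.bd q , y-uv

    module _ (c : Fin n → Fin n → Bool) where

      recolour : Fin n → Fin n → Bool
      recolour u v = if does (inK4? u v) then innerColour u v else c u v

      recolour-InK4 : ∀ {u v} → InK4 u v → recolour u v ≡ innerColour u v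
      recolour-InK4 {u} {v} k rewrite dec-true (inK4? u v) k = refl

      recolour-¬InK4 : ∀ {u v} → ¬ InK4 u v → recolour u v ≡ c u v
      recolour-¬InK4 {u} {v} ¬k rewrite dec-false (inK4? u v) ¬k = refl

      recolour-sym : (∀ u v → c u v ≡ c v u) → ∀ u v → recolour u v ≡ recolour v u
      recolour-sym c-sym u v rewrite does-inK4?-sym u v | innerColour-sym u v | c-sym u v = refl

      K4-colour : ∀ {u v x y col} → K4 u v x y → recolour u v ≡ col → spans u v x y ≡ col
      K4-colour q uv = trans (sym (innerColour-K4 q)) (trans (sym (recolour-InK4 (_ , _ , q))) uv)

      monochromatic-in-removeK4 : MonoTriangle G recolour → MonoTriangle removeK4 c
      monochromatic-in-removeK4 (a , b , d , col , ab , bd , ad , cab , cbd , cad) =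
        case inK4? a b of λ where
          (yes k) → let e , q = K4-extend k ad bd in
            ⊥-elim (spans-not-monochromatic (Edge⇒≢ ab) (Edge⇒≢ bd) (Edge⇒≢ ad) e
                      (K4-colour q cab)
                      (K4-colour (K4-swap₂₃ (K4-swap₁₂ q)) cbd)
                      (K4-colour (K4-swap₂₃ q) cad))
          (no ¬ab) → let ¬ad = ¬ab ∘ proj₁ ∘ λ k → InK4-triangle k ab (Edge-sym bd)
                         ¬bd = ¬ab ∘ InK4-sym ∘ proj₁ ∘ λ k → InK4-triangle k (Edge-sym ab) (Edge-sym ad) in
            a , b , d , col ,
            removeK4-edge ab ¬ab , removeK4-edge bd ¬bd , removeK4-edge ad ¬ad ,
            trans (sym (recolour-¬InK4 ¬ab)) cab ,
            trans (sym (recolour-¬InK4 ¬bd)) cbd ,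
            trans (sym (recolour-¬InK4 ¬ad)) cad

    removeK4-arrows : Arrows G → Arrows removeK4
    removeK4-arrows arrows (c , c-sym) =
      monochromatic-in-removeK4 c (arrows (recolour c , recolour-sym c c-sym))

hat₄₂-to-K₄ : ∀ {m} → FolkmanGraphExists (hatAdj 4 2) m → FolkmanGraphExists (completeAdj 4) m
hat₄₂-to-K₄ (G , free , arrows) = removeK4 G , removeK4-K4-free G , removeK4-arrows G free arrows
  where open K4Removal

lemma7 : ∀ m →
    (IsFe (hatAdj 4 2) m ⇔ IsFe (completeAdj 4) m) ×
    (IsFe (hatAdj 4 1) m ⇔ IsFe (completeAdj 4) m)
lemma7 m =
  IsLeast-cong (λ _ → mk⇔ hat₄₂-to-K₄ (hat₄₁-to-hat₄₂ ∘ K₄-to-hat₄₁)) m ,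
  IsLeast-cong (λ _ → mk⇔ (hat₄₂-to-K₄ ∘ hat₄₁-to-hat₄₂) K₄-to-hat₄₁) m
  where
  K₄-to-hat₄₁ : ∀ {n} → FolkmanGraphExists (completeAdj 4) n → FolkmanGraphExists (hatAdj 4 1) n
  K₄-to-hat₄₁ = FolkmanGraphExists-mono (complete↪hat 4 1)
  hat₄₁-to-hat₄₂ : ∀ {n} → FolkmanGraphExists (hatAdj 4 1) n → FolkmanGraphExists (hatAdj 4 2) n
  hat₄₁-to-hat₄₂ = FolkmanGraphExists-mono (hat↪hat (s≤s z≤n))
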